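{- Let $n\ge 6$ be an integer and let $V_1\cup V_2\cup V_3=[n]$ be a partition of $[n]$ (parts possibly empty). Then $\|\mathbb{C}[V_1,V_2,V_3]\|_2\le\|\mathbb{C}_n\|_2$.
   Context: For pairwise disjoint sets $V_1,V_2,V_3$, $\mathbb{C}[V_1,V_2,V_3]$ is the $3$-graph on $V_1\cup V_2\cup V_3$ consisting of all $3$-sets $e$ with $(|e\cap V_1|,|e\cap V_2|,|e\cap V_3|)\in\{(1,1,1),(2,1,0),(0,2,1),(1,0,2)\}$; $\mathbb{C}_n$ is $\mathbb{C}[V_1,V_2,V_3]$ for a partition of $[n]$ into parts whose sizes pairwise differ by at most one. For a $3$-graph $\mathcal{H}$ on $V$, $\|\mathcal{H}\|_2=\sum_{e\in\binom{V}{2}}d_{\mathcal{H}}(e)^2$, where $d_{\mathcal{H}}(e)$ is the number of edges containing the pair $e$. -}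

module Defs where

open import Data.Nat using (ℕ; zero; suc; _+_; _*_; _≤_; _<ᵇ_)
open import Data.Bool using (Bool; true; false; _∧_; not)
open import Data.Fin using (Fin; toℕ; zero; suc)
open import Data.Fin.Properties using (_≟_)
open import Data.List using (List; length; filterᵇ; map; concatMap; allFin)
open import Data.Nat.ListAction using (sum)
open import Relation.Nullary.Decidable using (⌊_⌋)

-- A partition V₁ ∪ V₂ ∪ V₃ of [n] = Fin n (parts possibly empty) is
-- a labelling of the vertices by Fin 3 : vertex v lies in V_(i+1) iff V v = i.
Partition : ℕ → Set
Partition n = Fin n → Fin 3

cnt : Fin 3 → Fin 3 → Fin 3 → Fin 3 → ℕ
cnt i a b c = b2n ⌊ a ≟ i ⌋ + b2n ⌊ b ≟ i ⌋ + b2n ⌊ c ≟ i ⌋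
  where
  b2n : Bool → ℕ
  b2n true = 1
  b2n false = 0

typeOK : ℕ → ℕ → ℕ → Bool
typeOK 1 1 1 = true
typeOK 2 1 0 = true
typeOK 0 2 1 = true
typeOK 1 0 2 = true
typeOK _ _ _ = false

-- Membership of the 3-set {x,y,z} (x,y,z pairwise distinct) in C[V₁,V₂,V₃],
-- determined by (|e ∩ V₁|, |e ∩ V₂|, |e ∩ V₃|).
isEdgeC : ∀ {n} → Partition n → Fin n → Fin n → Fin n → Bool
isEdgeC V x y z =
  typeOK (cnt zero (V x) (V y) (V z))
         (cnt (suc zero) (V x) (V y) (V z))
         (cnt (suc (suc zero)) (V x) (V y) (V z))

codeg : ∀ {n} → Partition n → Fin n → Fin n → ℕ
codeg {n} V x y =
  length (filterᵇ (λ z → not ⌊ z ≟ x ⌋ ∧ not ⌊ z ≟ y ⌋ ∧ isEdgeC V x y z) (allFin n))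

norm2 : ∀ {n} → Partition n → ℕ
norm2 {n} V =
  sum (concatMap (λ x →
         map (λ y → codeg V x y * codeg V x y)
             (filterᵇ (λ y → toℕ x <ᵇ toℕ y) (allFin n)))
       (allFin n))

partSize : ∀ {n} → Partition n → Fin 3 → ℕ
partSize {n} V i = length (filterᵇ (λ z → ⌊ V z ≟ i ⌋) (allFin n))

Balanced : ∀ {n} → Partition n → Set
Balanced V = ∀ i j → partSize V i ≤ partSize V j + 1

module Submission where

-- Write s = (a, b, c) for the part sizes.  A pair inside V₁ has codegree b, a pair
-- meeting V₁ and V₂ has codegree a − 1 + c, and cyclically, so 2‖C[V₁,V₂,V₃]‖₂ is a
-- polynomial Φ(s) in the part sizes, invariant under cyclic rotation of s.  Moving one
-- vertex from V₂ to V₁ when |V₂| ≥ |V₁| + 2 (or the rotated move) does not decrease Φ, and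
-- while s is unbalanced such a move exists, except for rotations of (w, w+1, w+2), which
-- go straight to (w+1, w+1, w+1).  These moves decrease a² + b² + c², so every s descends
-- to a balanced triple of the same total; balanced triples of equal total are rotations
-- of one another.  The certificates of the moves are explicit polynomials with
-- nonnegative coefficients.

open import Algebra.Bundles.Raw using (RawSemiring)
open import Data.Bool.Base using (Bool; true; false; if_then_else_; not; _∧_; T)
open import Data.Fin.Base using (Fin; zero; suc; toℕ)
open import Data.Fin.Patterns using (0F; 1F; 2F)
open import Data.Product.Base using (Σ; ∃₂; _×_; _,_; proj₁; proj₂)
open import Level using (0ℓ)
open import Defs

edgeType : Fin 3 → Fin 3 → Fin 3 → Bool
edgeType i j k = typeOK (cnt 0F i j k) (cnt 1F i j k) (cnt 2F i j k)

-- The quantities below are polynomials in the part sizes.  They are written once over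
-- an arbitrary raw semiring: at ℕ they are the quantities themselves, at the syntax of
-- Data.Nat.Solver they are the input of the ring solver, which can then expand them.
module SizePolynomials (R : RawSemiring 0ℓ 0ℓ) where
  open RawSemiring R
  open import Algebra.Definitions.RawMonoid +-rawMonoid using (sum)

  Triple : Set
  Triple = Carrier × Carrier × Carrier

  part : Triple → Fin 3 → Carrier
  part (a , _ , _) 0F = a
  part (_ , b , _) 1F = b
  part (_ , _ , c) 2F = c

  total squares : Triple → Carrier
  total (a , b , c) = a + b + c
  squares (a , b , c) = a * a + b * b + c * c

  𝟙 : Bool → Carrier
  𝟙 b = if b then 1# else 0#

  -- For x, y in parts i, j: the number of z ∈ [n] with {x, y, z} of edge type, where z
  -- may be x or y, and the number of those z among {x, y}.  The codegree of {x, y} is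
  -- their difference.
  completions : Triple → Fin 3 → Fin 3 → Carrier
  completions s i j = sum λ k → part s k * 𝟙 (edgeType i j k)

  repeated : Fin 3 → Fin 3 → Carrier
  repeated i j = 𝟙 (edgeType i j i) + 𝟙 (edgeType i j j)

  squaredTerms crossTerms : Triple → Fin 3 → Fin 3 → Carrier
  squaredTerms s i j = completions s i j * completions s i j + repeated i j * repeated i j
  crossTerms s i j = (1# + 1#) * (repeated i j * completions s i j)

  -- (quadratic − diagonal) s h is twice the sum of h over the pairs of distinct vertices.
  quadratic diagonal : Triple → (Fin 3 → Fin 3 → Carrier) → Carrier
  quadratic s h = sum λ i → part s i * sum λ j → part s j * h i j
  diagonal s h = sum λ i → part s i * h i i

  -- Φ⁺ s − Φ⁻ s = 2‖C[V₁,V₂,V₃]‖₂ = Σ_cyclic (a(a−1)b² + 2ab(a+c−1)²).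
  Φ⁺ Φ⁻ : Triple → Carrier
  Φ⁺ s = quadratic s (squaredTerms s) + diagonal s (crossTerms s)
  Φ⁻ s = quadratic s (crossTerms s) + diagonal s (squaredTerms s)

open import Data.Empty using (⊥-elim)
open import Data.Fin.Properties using (_≟_; toℕ-injective; toℕ<n)
open import Data.List.Base using (List; []; _∷_; length; map; filterᵇ; tabulate; concatMap; allFin)
open import Data.Nat.Base using (ℕ; zero; suc; _+_; _*_; _≤_; _<_; _≥_; _<ᵇ_; s≤s; +-*-rawSemiring)
open import Data.Nat.DivMod using (_%_; [m+kn]%n≡m%n; m<n⇒m%n≡m)
open import Data.Nat.Induction using (<-wellFounded)
open import Data.Nat.ListAction using (sum)
open import Data.Nat.ListAction.Properties using (sum-++)
open import Data.Nat.Properties hiding (_≟_)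
open import Data.Nat.Solver using (module +-*-Solver)
open import Data.Sum.Base using (_⊎_; inj₁; inj₂)
open import Function.Base using (_∘_)
open import Induction.WellFounded using (Acc; acc)
open import Relation.Binary.PropositionalEquality
open import Relation.Nullary.Decidable using (⌊_⌋; ⌊⌋-map′; isYes≗does; dec-false; yes; no)
open import Relation.Nullary.Negation.Core using (¬_)
open import Algebra.Properties.Semiring.Sum +-*-semiring
  using (sum-syntax; sum-cong-≗; ∑-comm; ∑-distrib-+; *-distribʳ-sum; sum-replicate-zero)
open +-*-Solver using (solve; _:=_; _:+_; _:*_; _:^_; con; Polynomial)

open SizePolynomials +-*-rawSemiring

polynomials : ℕ → RawSemiring 0ℓ 0ℓ
polynomials m = record
  { Carrier = Polynomial m ; _≈_ = _≡_ ; _+_ = _:+_ ; _*_ = _:*_ ; 0# = con 0 ; 1# = con 1 }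

module Symbolic {m : ℕ} = SizePolynomials (polynomials m)

-- Counting vertices by part


sum-concatMap : ∀ {A : Set} (F : A → List ℕ) xs → sum (concatMap F xs) ≡ sum (map (sum ∘ F) xs)
sum-concatMap F []       = refl
sum-concatMap F (x ∷ xs) =
  trans (sum-++ (F x) (concatMap F xs)) (cong (sum (F x) +_) (sum-concatMap F xs))

sum-map-tabulate : ∀ {A : Set} {n} (f : A → ℕ) (g : Fin n → A) →
  sum (map f (tabulate g)) ≡ ∑[ i < n ] f (g i)
sum-map-tabulate {n = zero}  f g = refl
sum-map-tabulate {n = suc n} f g = cong (f (g zero) +_) (sum-map-tabulate f (g ∘ suc))

sum-map-filterᵇ-tabulate : ∀ {A : Set} {n} (f : A → ℕ) (p : A → Bool) (g : Fin n → A) →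
  sum (map f (filterᵇ p (tabulate g))) ≡ ∑[ i < n ] (if p (g i) then f (g i) else 0)
sum-map-filterᵇ-tabulate {n = zero}  f p g = refl
sum-map-filterᵇ-tabulate {n = suc n} f p g with p (g zero)
... | true  = cong (f (g zero) +_) (sum-map-filterᵇ-tabulate f p (g ∘ suc))
... | false = sum-map-filterᵇ-tabulate f p (g ∘ suc)

length-filterᵇ-tabulate : ∀ {A : Set} {n} (p : A → Bool) (g : Fin n → A) →
  length (filterᵇ p (tabulate g)) ≡ ∑[ i < n ] 𝟙 (p (g i))
length-filterᵇ-tabulate {n = zero}  p g = refl
length-filterᵇ-tabulate {n = suc n} p g with p (g zero)
... | true  = cong suc (length-filterᵇ-tabulate p (g ∘ suc))
... | false = length-filterᵇ-tabulate p (g ∘ suc)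

∑-const-1 : ∀ n → ∑[ i < n ] 1 ≡ n
∑-const-1 zero    = refl
∑-const-1 (suc n) = cong suc (∑-const-1 n)

∑-𝟙≟ : ∀ {k} (j : Fin k) (f : Fin k → ℕ) → ∑[ i < k ] (𝟙 ⌊ j ≟ i ⌋ * f i) ≡ f j
∑-𝟙≟ {suc k} zero f =
  trans (cong (f zero + 0 +_) (sum-replicate-zero k)) (trans (+-identityʳ _) (+-identityʳ _))
∑-𝟙≟ {suc k} (suc j) f =
  trans (sum-cong-≗ λ i → cong (λ b → 𝟙 b * f (suc i)) (⌊⌋-map′ _ _ (j ≟ i))) (∑-𝟙≟ j (f ∘ suc))

size : ∀ {n k} → (Fin n → Fin k) → Fin k → ℕ
size {n} V i = ∑[ z < n ] 𝟙 ⌊ V z ≟ i ⌋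

sizes : ∀ {n} → Partition n → Triple
sizes V = size V 0F , size V 1F , size V 2F

∑-by-colour : ∀ {n k} (V : Fin n → Fin k) (f : Fin k → ℕ) →
  ∑[ z < n ] f (V z) ≡ ∑[ i < k ] (size V i * f i)
∑-by-colour {n} {k} V f = begin
  ∑[ z < n ] f (V z)                          ≡⟨ sum-cong-≗ (λ z → sym (∑-𝟙≟ (V z) f)) ⟩
  ∑[ z < n ] ∑[ i < k ] (𝟙 ⌊ V z ≟ i ⌋ * f i)  ≡⟨ ∑-comm (λ z i → 𝟙 ⌊ V z ≟ i ⌋ * f i) ⟩
  ∑[ i < k ] ∑[ z < n ] (𝟙 ⌊ V z ≟ i ⌋ * f i)  ≡⟨ sum-cong-≗ (λ i → *-distribʳ-sum (f i) (λ z → 𝟙 ⌊ V z ≟ i ⌋)) ⟨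
  ∑[ i < k ] (size V i * f i)                   ∎
  where open ≡-Reasoning

partSize≡size : ∀ {n} (V : Partition n) i → partSize V i ≡ size V i
partSize≡size V i = length-filterᵇ-tabulate (λ z → ⌊ V z ≟ i ⌋) (λ z → z)

total-sizes : ∀ {n} (V : Partition n) → total (sizes V) ≡ n
total-sizes {n} V = begin
  total (sizes V)            ≡⟨ solve 3 (λ a b c → a :+ b :+ c := a :* con 1 :+ (b :* con 1 :+ (c :* con 1 :+ con 0)))
                                       refl (size V 0F) (size V 1F) (size V 2F) ⟩
  ∑[ i < 3 ] (size V i * 1)  ≡⟨ ∑-by-colour V (λ _ → 1) ⟨
  ∑[ z < n ] 1               ≡⟨ ∑-const-1 n ⟩
  n                          ∎
  where open ≡-Reasoning

-- The norm as a polynomial in the part sizes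


sumPairs : ∀ {n} → (Fin n → Fin n → ℕ) → ℕ
sumPairs {n} g = ∑[ x < n ] ∑[ y < n ] (if toℕ x <ᵇ toℕ y then g x y else 0)

norm2≡sumPairs : ∀ {n} (V : Partition n) → norm2 V ≡ sumPairs (λ x y → codeg V x y * codeg V x y)
norm2≡sumPairs {n} V = begin
  norm2 V                                          ≡⟨ sum-concatMap _ (allFin n) ⟩
  sum (map (sum ∘ pairsFrom) (allFin n))           ≡⟨ sum-map-tabulate (sum ∘ pairsFrom) (λ x → x) ⟩
  ∑[ x < n ] sum (pairsFrom x)                     ≡⟨ sum-cong-≗ (λ x → sum-map-filterᵇ-tabulate
                                                        (λ y → codeg V x y * codeg V x y) (λ y → toℕ x <ᵇ toℕ y) (λ y → y)) ⟩
  sumPairs (λ x y → codeg V x y * codeg V x y)     ∎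
  where
  open ≡-Reasoning
  pairsFrom : Fin n → List ℕ
  pairsFrom x = map (λ y → codeg V x y * codeg V x y) (filterᵇ (λ y → toℕ x <ᵇ toℕ y) (allFin n))

sumPairs-+ : ∀ {n} {g h k : Fin n → Fin n → ℕ} → (∀ x y → toℕ x < toℕ y → g x y + h x y ≡ k x y) →
  sumPairs g + sumPairs h ≡ sumPairs k
sumPairs-+ {n} {g} {h} {k} g+h≡k =
  trans (sym (∑-distrib-+ (λ x → ∑[ y < n ] below g x y) (λ x → ∑[ y < n ] below h x y))) (sum-cong-≗ λ x →
  trans (sym (∑-distrib-+ (below g x) (below h x))) (sum-cong-≗ λ y → pointwise x y))
  where
  below : (Fin n → Fin n → ℕ) → Fin n → Fin n → ℕ
  below f x y = if toℕ x <ᵇ toℕ y then f x y else 0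
  pointwise : ∀ x y → below g x y + below h x y ≡ below k x y
  pointwise x y with toℕ x <ᵇ toℕ y in lt
  ... | true  = g+h≡k x y (<ᵇ⇒< _ _ (subst T (sym lt) _))
  ... | false = refl

-- Vertex 0 contributes its row R to sumPairs, and by symmetry its column is also R.
sumPairs-double : ∀ {n} (g : Fin n → Fin n → ℕ) → (∀ x y → g x y ≡ g y x) →
  2 * sumPairs g + ∑[ x < n ] g x x ≡ ∑[ x < n ] ∑[ y < n ] g x y
sumPairs-double {zero}  g g-sym = refl
sumPairs-double {suc n} g g-sym = begin
  2 * (R + S) + (g 0F 0F + D)
    ≡⟨ rearrange (g 0F 0F) R S D ⟩
  g 0F 0F + R + (R + (2 * S + D))
    ≡⟨ cong₂ (λ u v → g 0F 0F + R + (u + v)) column (sumPairs-double g′ (λ x y → g-sym (suc x) (suc y))) ⟩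
  g 0F 0F + R + (∑[ x < n ] g (suc x) 0F + ∑[ x < n ] ∑[ y < n ] g′ x y)
    ≡⟨ cong (g 0F 0F + R +_) (∑-distrib-+ (λ x → g (suc x) 0F) (λ x → ∑[ y < n ] g′ x y)) ⟨
  ∑[ x < suc n ] ∑[ y < suc n ] g x y
    ∎
  where
  open ≡-Reasoning
  g′ : Fin n → Fin n → ℕ
  g′ x y = g (suc x) (suc y)
  R = ∑[ y < n ] g 0F (suc y)
  S = sumPairs g′
  D = ∑[ x < n ] g′ x x
  column : R ≡ ∑[ x < n ] g (suc x) 0F
  column = sum-cong-≗ λ y → g-sym 0F (suc y)
  rearrange : ∀ g₀ R S D → 2 * (R + S) + (g₀ + D) ≡ g₀ + R + (R + (2 * S + D))
  rearrange = solve 4 (λ g₀ R S D → con 2 :* (R :+ S) :+ (g₀ :+ D) := g₀ :+ R :+ (R :+ (con 2 :* S :+ D)))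
                      refl

sumPairs-by-colour : ∀ {n k} (V : Fin n → Fin k) (h : Fin k → Fin k → ℕ) → (∀ i j → h i j ≡ h j i) →
  2 * sumPairs (λ x y → h (V x) (V y)) + ∑[ i < k ] (size V i * h i i)
    ≡ ∑[ i < k ] (size V i * ∑[ j < k ] (size V j * h i j))
sumPairs-by-colour {n} {k} V h h-sym = begin
  2 * S + ∑[ i < k ] (size V i * h i i)                 ≡⟨ cong (2 * S +_) (∑-by-colour V (λ i → h i i)) ⟨
  2 * S + ∑[ x < n ] h (V x) (V x)                      ≡⟨ sumPairs-double _ (λ x y → h-sym (V x) (V y)) ⟩
  ∑[ x < n ] ∑[ y < n ] h (V x) (V y)                   ≡⟨ sum-cong-≗ (λ x → ∑-by-colour V (h (V x))) ⟩
  ∑[ x < n ] ∑[ j < k ] (size V j * h (V x) j)          ≡⟨ ∑-by-colour V (λ i → ∑[ j < k ] (size V j * h i j)) ⟩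
  ∑[ i < k ] (size V i * ∑[ j < k ] (size V j * h i j)) ∎
  where
  open ≡-Reasoning
  S = sumPairs (λ x y → h (V x) (V y))

count-except : ∀ {n} (x : Fin n) (p : Fin n → Bool) →
  ∑[ z < n ] 𝟙 (not ⌊ z ≟ x ⌋ ∧ p z) + 𝟙 (p x) ≡ ∑[ z < n ] 𝟙 (p z)
count-except zero    p = +-comm _ (𝟙 (p zero))
count-except (suc x) p = trans (+-assoc (𝟙 (p zero)) _ _) (cong (𝟙 (p zero) +_) (trans
  (cong (_+ 𝟙 (p (suc x))) (sum-cong-≗ λ z → cong (λ b → 𝟙 (not b ∧ p (suc z))) (⌊⌋-map′ _ _ (z ≟ x))))
  (count-except x (p ∘ suc))))

codeg+repeated : ∀ {n} (V : Partition n) {x y} → x ≢ y →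
  codeg V x y + repeated (V x) (V y) ≡ completions (sizes V) (V x) (V y)
codeg+repeated {n} V {x} {y} x≢y = begin
  codeg V x y + (𝟙 (edge x) + 𝟙 (edge y))                              ≡⟨ +-assoc (codeg V x y) _ _ ⟨
  codeg V x y + 𝟙 (edge x) + 𝟙 (edge y)                                ≡⟨ cong₂ (λ c b → c + 𝟙 (b ∧ edge x) + 𝟙 (edge y))
      (length-filterᵇ-tabulate (λ z → not ⌊ z ≟ x ⌋ ∧ avoidsY z) (λ z → z))
      (sym (cong not (trans (isYes≗does (x ≟ y)) (dec-false (x ≟ y) x≢y)))) ⟩
  ∑[ z < n ] 𝟙 (not ⌊ z ≟ x ⌋ ∧ avoidsY z) + 𝟙 (avoidsY x) + 𝟙 (edge y) ≡⟨ cong (_+ 𝟙 (edge y)) (count-except x avoidsY) ⟩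
  ∑[ z < n ] 𝟙 (not ⌊ z ≟ y ⌋ ∧ edge z) + 𝟙 (edge y)                   ≡⟨ count-except y edge ⟩
  ∑[ z < n ] 𝟙 (edge z)                                                ≡⟨ ∑-by-colour V (λ k → 𝟙 (edgeType (V x) (V y) k)) ⟩
  completions (sizes V) (V x) (V y)                                    ∎
  where
  open ≡-Reasoning
  edge avoidsY : Fin n → Bool
  edge z = isEdgeC V x y z
  avoidsY z = not ⌊ z ≟ y ⌋ ∧ edge z

edgeType-sym : ∀ i j k → edgeType i j k ≡ edgeType j i k
edgeType-sym 0F 0F k = refl
edgeType-sym 0F 1F k = refl
edgeType-sym 0F 2F k = refl
edgeType-sym 1F 0F k = refl
edgeType-sym 1F 1F k = refl
edgeType-sym 1F 2F k = refl
edgeType-sym 2F 0F k = refl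
edgeType-sym 2F 1F k = refl
edgeType-sym 2F 2F k = refl

completions-sym : ∀ s i j → completions s i j ≡ completions s j i
completions-sym s i j = sum-cong-≗ λ k → cong (λ b → part s k * 𝟙 b) (edgeType-sym i j k)

repeated-sym : ∀ i j → repeated i j ≡ repeated j i
repeated-sym i j = trans (cong₂ (λ b b′ → 𝟙 b + 𝟙 b′) (edgeType-sym i j i) (edgeType-sym i j j))
                         (+-comm (𝟙 (edgeType j i i)) (𝟙 (edgeType j i j)))

square-of-difference : ∀ d r e → d + r ≡ e → d * d + 2 * (r * e) ≡ e * e + r * r
square-of-difference d r _ refl =
  solve 2 (λ d r → d :* d :+ con 2 :* (r :* (d :+ r)) := (d :+ r) :* (d :+ r) :+ r :* r) refl d r

norm2-identity : ∀ {n} (V : Partition n) → 2 * norm2 V + Φ⁻ (sizes V) ≡ Φ⁺ (sizes V)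
norm2-identity V = begin
  2 * norm2 V + (quadratic s (crossTerms s) + D₁)    ≡⟨ cong (λ q → 2 * norm2 V + (q + D₁))
                                                          (sumPairs-by-colour V (crossTerms s) crossTerms-sym) ⟨
  2 * norm2 V + (2 * S₂ + D₂ + D₁)                   ≡⟨ rearrange (norm2 V) S₂ D₁ D₂ ⟩
  2 * (norm2 V + S₂) + D₁ + D₂                       ≡⟨ cong (λ t → 2 * t + D₁ + D₂) codegree-step ⟩
  2 * S₁ + D₁ + D₂                                   ≡⟨ cong (_+ D₂) (sumPairs-by-colour V (squaredTerms s) squaredTerms-sym) ⟩
  quadratic s (squaredTerms s) + D₂                  ∎
  where
  open ≡-Reasoning
  s = sizes V
  S₁ = sumPairs (λ x y → squaredTerms s (V x) (V y))
  S₂ = sumPairs (λ x y → crossTerms s (V x) (V y))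
  D₁ = diagonal s (squaredTerms s)
  D₂ = diagonal s (crossTerms s)
  squaredTerms-sym : ∀ i j → squaredTerms s i j ≡ squaredTerms s j i
  squaredTerms-sym i j = cong₂ (λ e r → e * e + r * r) (completions-sym s i j) (repeated-sym i j)
  crossTerms-sym : ∀ i j → crossTerms s i j ≡ crossTerms s j i
  crossTerms-sym i j = cong₂ (λ e r → 2 * (r * e)) (completions-sym s i j) (repeated-sym i j)
  codegree-squared : ∀ x y → toℕ x < toℕ y →
    codeg V x y * codeg V x y + crossTerms s (V x) (V y) ≡ squaredTerms s (V x) (V y)
  codegree-squared x y x<y = square-of-difference (codeg V x y) (repeated (V x) (V y)) _
    (codeg+repeated V (λ x≡y → <-irrefl (cong toℕ x≡y) x<y))
  codegree-step : norm2 V + S₂ ≡ S₁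
  codegree-step = trans (cong (_+ S₂) (norm2≡sumPairs V)) (sumPairs-+ codegree-squared)
  rearrange : ∀ N S D D′ → 2 * N + (2 * S + D′ + D) ≡ 2 * (N + S) + D + D′
  rearrange = solve 4 (λ N S D D′ → con 2 :* N :+ (con 2 :* S :+ D′ :+ D) := con 2 :* (N :+ S) :+ D :+ D′)
                      refl

-- Comparing part-size triples


infix 4 _≼_ _≋_ _≼[_]_

-- x ≼ y says Φ⁺ x − Φ⁻ x ≤ Φ⁺ y − Φ⁻ y, with the terms moved so that no subtraction occurs.
record _≼_ (x y : Triple) : Set where
  constructor ≼-intro
  field ≼-elim : Φ⁺ x + Φ⁻ y ≤ Φ⁺ y + Φ⁻ x

open _≼_

≼-refl : ∀ {x} → x ≼ x
≼-refl = ≼-intro ≤-refl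

≼-trans : ∀ {x y z} → x ≼ y → y ≼ z → x ≼ z
≼-trans {x} {y} {z} x≼y y≼z = ≼-intro (+-cancelʳ-≤ (Φ⁺ y + Φ⁻ y) _ _
  (subst₂ _≤_ (left (Φ⁺ x) (Φ⁻ y) (Φ⁺ y) (Φ⁻ z)) (right (Φ⁺ y) (Φ⁻ x) (Φ⁺ z) (Φ⁻ y))
    (+-mono-≤ (≼-elim x≼y) (≼-elim y≼z))))
  where
  left : ∀ a b c d → a + b + (c + d) ≡ a + d + (c + b)
  left = solve 4 (λ a b c d → a :+ b :+ (c :+ d) := a :+ d :+ (c :+ b)) refl
  right : ∀ a b c d → a + b + (c + d) ≡ c + b + (a + d)
  right = solve 4 (λ a b c d → a :+ b :+ (c :+ d) := c :+ b :+ (a :+ d)) refl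

≤-by : ∀ {m n} k → m + k ≡ n → m ≤ n
≤-by {m} k eq = subst (m ≤_) eq (m≤m+n m k)

≼-by : ∀ {x y} Δ → Φ⁺ x + Φ⁻ y + Δ ≡ Φ⁺ y + Φ⁻ x → x ≼ y
≼-by Δ eq = ≼-intro (≤-by Δ eq)

_≼[_]_ : ∀ {m} → Symbolic.Triple {m} → Polynomial m → Symbolic.Triple {m} → Polynomial m × Polynomial m
x ≼[ Δ ] y = Symbolic.Φ⁺ x :+ Symbolic.Φ⁻ y :+ Δ := Symbolic.Φ⁺ y :+ Symbolic.Φ⁻ x

record _≋_ (x y : Triple) : Set where
  field
    total-≡ : total x ≡ total y
    Φ⁺-≡    : Φ⁺ x ≡ Φ⁺ y
    Φ⁻-≡    : Φ⁻ x ≡ Φ⁻ y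

≋-refl : ∀ {x} → x ≋ x
≋-refl = record { total-≡ = refl ; Φ⁺-≡ = refl ; Φ⁻-≡ = refl }

≋-sym : ∀ {x y} → x ≋ y → y ≋ x
≋-sym x≋y = record { total-≡ = sym total-≡ ; Φ⁺-≡ = sym Φ⁺-≡ ; Φ⁻-≡ = sym Φ⁻-≡ }
  where open _≋_ x≋y

≋-trans : ∀ {x y z} → x ≋ y → y ≋ z → x ≋ z
≋-trans x≋y y≋z = record
  { total-≡ = trans (total-≡ x≋y) (total-≡ y≋z)
  ; Φ⁺-≡    = trans (Φ⁺-≡ x≋y) (Φ⁺-≡ y≋z)
  ; Φ⁻-≡    = trans (Φ⁻-≡ x≋y) (Φ⁻-≡ y≋z)
  }
  where open _≋_

≋⇒≼ : ∀ {x y} → x ≋ y → x ≼ y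
≋⇒≼ x≋y = ≼-intro (≤-reflexive (cong₂ _+_ Φ⁺-≡ (sym Φ⁻-≡)))
  where open _≋_ x≋y

rotate : Triple → Triple
rotate (a , b , c) = b , c , a

rotate-≋ : ∀ x → rotate x ≋ x
rotate-≋ (a , b , c) = record
  { total-≡ = solve 3 (λ a b c → Symbolic.total (b , c , a) := Symbolic.total (a , b , c)) refl a b c
  ; Φ⁺-≡    = solve 3 (λ a b c → Symbolic.Φ⁺ (b , c , a) := Symbolic.Φ⁺ (a , b , c)) refl a b c
  ; Φ⁻-≡    = solve 3 (λ a b c → Symbolic.Φ⁻ (b , c , a) := Symbolic.Φ⁻ (a , b , c)) refl a b c
  }

squares-rotate : ∀ x → squares (rotate x) ≡ squares x
squares-rotate (a , b , c) =
  solve 3 (λ a b c → Symbolic.squares (b , c , a) := Symbolic.squares (a , b , c)) refl a b c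

-- As a polynomial in (a, d, c), Φ(after) − Φ(before) has negative coefficients; it has none
-- after substituting each of the regimes c = 0, 0 < c ≤ a and a < c.
forward-move : ∀ a d c → (a , 2 + a + d , c) ≼ (1 + a , 1 + a + d , c)
forward-move a d zero = ≼-by _ (solve 2 (λ a d →
  (a , con 2 :+ a :+ d , con 0) ≼[ con 4 :* a :^ 3 :+ con 8 :* a :^ 2 :* d :+ con 2 :* a :* d :^ 2
                                  :+ con 11 :* a :^ 2 :+ con 4 :* a :* d :+ a ]
  (con 1 :+ a , con 1 :+ a :+ d , con 0)) refl a d)
forward-move a d (suc z) with suc z ≤? a
... | yes c≤a with e , refl ← m≤n⇒∃[o]m+o≡n c≤a = ≼-by _ (solve 3 (λ e d z →
  (con 1 :+ z :+ e , con 2 :+ (con 1 :+ z :+ e) :+ d , con 1 :+ z)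
    ≼[ con 4 :* e :^ 3 :+ con 8 :* e :^ 2 :* d :+ con 6 :* e :^ 2 :* z :+ con 2 :* e :* d :^ 2
       :+ con 16 :* e :* d :* z :+ con 2 :* d :^ 2 :* z :+ con 12 :* d :* z :^ 2 :+ con 17 :* e :^ 2
       :+ con 20 :* e :* d :+ con 22 :* e :* z :+ con 2 :* d :^ 2 :+ con 24 :* d :* z :+ con 12 :* z :^ 2
       :+ con 23 :* e :+ con 12 :* d :+ con 22 :* z :+ con 10 ]
  (con 2 :+ z :+ e , con 1 :+ (con 1 :+ z :+ e) :+ d , con 1 :+ z)) refl e d z)
... | no c≰a with w , refl ← m≤n⇒∃[o]m+o≡n (≤-pred (≰⇒> c≰a)) = ≼-by _ (solve 3 (λ a d w →
  (a , con 2 :+ a :+ d , con 1 :+ a :+ w)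
    ≼[ con 12 :* a :^ 2 :* d :+ con 2 :* a :* d :^ 2 :+ con 8 :* a :* d :* w :+ con 6 :* a :* w :^ 2
       :+ con 4 :* d :* w :^ 2 :+ con 2 :* w :^ 3 :+ con 12 :* a :^ 2 :+ con 8 :* a :* d :+ con 14 :* a :* w
       :+ con 4 :* d :* w :+ con 7 :* w :^ 2 :+ con 6 :* a :+ con 5 :* w ]
  (con 1 :+ a , con 1 :+ a :+ d , con 1 :+ a :+ w)) refl a d w)

staircase-move : ∀ w → (w , 1 + w , 2 + w) ≼ (1 + w , 1 + w , 1 + w)
staircase-move w = ≼-by _ (solve 1 (λ w →
  (w , con 1 :+ w , con 2 :+ w) ≼[ con 12 :* w :^ 2 :+ con 18 :* w :+ con 6 ]
  (con 1 :+ w , con 1 :+ w , con 1 :+ w)) refl w)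

-- Descent to a balanced triple


record Improvement (x : Triple) : Set where
  field
    next         : Triple
    improves     : x ≼ next
    total-next   : total next ≡ total x
    squares-next : squares next < squares x

improvement-rotate : ∀ {x} → Improvement (rotate x) → Improvement x
improvement-rotate {x} imp = record
  { next         = next
  ; improves     = ≼-trans (≋⇒≼ (≋-sym (rotate-≋ x))) improves
  ; total-next   = trans total-next (_≋_.total-≡ (rotate-≋ x))
  ; squares-next = subst (squares next <_) (squares-rotate x) squares-next
  }
  where open Improvement imp

forward-improvement : ∀ {a b c} → 2 + a ≤ b → Improvement (a , b , c)
forward-improvement {a} {_} {c} gap with d , refl ← m≤n⇒∃[o]m+o≡n gap = record
  { next         = 1 + a , 1 + a + d , c
  ; improves     = forward-move a d c
  ; total-next   = solve 3 (λ a d c → Symbolic.total (con 1 :+ a , con 1 :+ a :+ d , c)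
                                    := Symbolic.total (a , con 2 :+ a :+ d , c)) refl a d c
  ; squares-next = ≤-by (2 * d + 1) (solve 3 (λ a d c →
      con 1 :+ Symbolic.squares (con 1 :+ a , con 1 :+ a :+ d , c) :+ (con 2 :* d :+ con 1)
        := Symbolic.squares (a , con 2 :+ a :+ d , c)) refl a d c)
  }

staircase-improvement : ∀ w → Improvement (w , 1 + w , 2 + w)
staircase-improvement w = record
  { next         = 1 + w , 1 + w , 1 + w
  ; improves     = staircase-move w
  ; total-next   = solve 1 (λ w → Symbolic.total (con 1 :+ w , con 1 :+ w , con 1 :+ w)
                                := Symbolic.total (w , con 1 :+ w , con 2 :+ w)) refl w
  ; squares-next = ≤-by 1 (solve 1 (λ w →
      con 1 :+ Symbolic.squares (con 1 :+ w , con 1 :+ w , con 1 :+ w) :+ con 1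
        := Symbolic.squares (w , con 1 :+ w , con 2 :+ w)) refl w)
  }

Near : ℕ → ℕ → Set
Near u v = u ≤ suc v × v ≤ suc u

Balanced₃ : Triple → Set
Balanced₃ (a , b , c) = Near a b × Near b c × Near c a

squeeze : ∀ {a b c} → 2 + a ≤ c → c ≤ suc b → b ≤ suc a → b ≡ suc a × c ≡ 2 + a
squeeze gap c≤ b≤ = ≤-antisym b≤ (≤-pred (≤-trans gap c≤)) , ≤-antisym (≤-trans c≤ (s≤s b≤)) gap

-- Without a forward gap, b ≤ a + 1, c ≤ b + 1 and a ≤ c + 1; then a backward gap of 2 pins the
-- triple down to a rotation of (w, w+1, w+2).
improve : ∀ x → Balanced₃ x ⊎ Improvement x
improve (a , b , c) with 2 + a ≤? b | 2 + b ≤? c | 2 + c ≤? a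
... | yes gap | _       | _       = inj₂ (forward-improvement gap)
... | no _    | yes gap | _       = inj₂ (improvement-rotate (forward-improvement gap))
... | no _    | no _    | yes gap = inj₂ (improvement-rotate (improvement-rotate (forward-improvement gap)))
... | no ab   | no bc   | no ca   = without-forward-gap (below ab) (below bc) (below ca)
  where
  below : ∀ {u v} → ¬ 2 + u ≤ v → v ≤ suc u
  below gap = ≤-pred (≰⇒> gap)
  without-forward-gap : b ≤ suc a → c ≤ suc b → a ≤ suc c →
                        Balanced₃ (a , b , c) ⊎ Improvement (a , b , c)
  without-forward-gap b≤ c≤ a≤ with 2 + a ≤? c | 2 + b ≤? a | 2 + c ≤? b
  ... | yes gap | _       | _       with refl , refl ← squeeze gap c≤ b≤ =
    inj₂ (staircase-improvement a)
  ... | no _    | yes gap | _       with refl , refl ← squeeze gap a≤ c≤ =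
    inj₂ (improvement-rotate (staircase-improvement b))
  ... | no _    | no _    | yes gap with refl , refl ← squeeze gap b≤ a≤ =
    inj₂ (improvement-rotate (improvement-rotate (staircase-improvement c)))
  ... | no ac   | no ba   | no cb   = inj₁ ((below ba , b≤) , (below cb , c≤) , (below ac , a≤))

descend : ∀ x → Acc _<_ (squares x) → Σ Triple λ y → Balanced₃ y × total y ≡ total x × x ≼ y
descend x (acc smaller) with improve x
... | inj₁ balanced = x , balanced , refl , ≼-refl
... | inj₂ imp =
  let open Improvement imp
      y , balanced , total-y , next≼y = descend next (smaller squares-next)
  in  y , balanced , trans total-y total-next , ≼-trans improves next≼y

near-cases : ∀ {u v} → Near u v → v ≡ u ⊎ v ≡ suc u ⊎ u ≡ suc v
near-cases (u≤ , v≤) with m≤n⇒m<n∨m≡n v≤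
... | inj₂ v≡ = inj₂ (inj₁ v≡)
... | inj₁ (s≤s v≤u) with m≤n⇒m<n∨m≡n u≤
...   | inj₂ u≡         = inj₂ (inj₂ u≡)
...   | inj₁ (s≤s u≤v) = inj₁ (≤-antisym v≤u u≤v)

canonical : ℕ → Fin 3 → Triple
canonical m 0F = m , m , m
canonical m 1F = suc m , m , m
canonical m 2F = suc m , suc m , m

total-canonical : ∀ m k → total (canonical m k) ≡ toℕ k + m * 3
total-canonical m 0F = solve 1 (λ m → m :+ m :+ m := con 0 :+ m :* con 3) refl m
total-canonical m 1F = solve 1 (λ m → con 1 :+ m :+ m :+ m := con 1 :+ m :* con 3) refl m
total-canonical m 2F = solve 1 (λ m → con 1 :+ m :+ (con 1 :+ m) :+ m := con 2 :+ m :* con 3) refl m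

canonical-unique : ∀ {m m′} {k k′ : Fin 3} → toℕ k + m * 3 ≡ toℕ k′ + m′ * 3 → m ≡ m′ × k ≡ k′
canonical-unique {m} {m′} {k} {k′} eq = m≡m′ , k≡k′
  where
  remainder : ∀ m (k : Fin 3) → (toℕ k + m * 3) % 3 ≡ toℕ k
  remainder m k = trans ([m+kn]%n≡m%n (toℕ k) m 3) (m<n⇒m%n≡m (toℕ<n k))
  k≡k′ : k ≡ k′
  k≡k′ = toℕ-injective (trans (sym (remainder m k)) (trans (cong (_% 3) eq) (remainder m′ k′)))
  m≡m′ : m ≡ m′
  m≡m′ = *-cancelʳ-≡ m m′ 3
           (+-cancelˡ-≡ (toℕ k) _ _ (trans eq (cong (λ i → toℕ i + m′ * 3) (sym k≡k′))))

rotate²-≋ : ∀ x → rotate (rotate x) ≋ x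
rotate²-≋ x = ≋-trans (rotate-≋ (rotate x)) (rotate-≋ x)

classify : ∀ x → Balanced₃ x → ∃₂ λ m k → x ≋ canonical m k
classify (a , b , c) (ab , bc , ca) with near-cases ab | near-cases bc
... | inj₁ refl        | inj₁ refl        = a , 0F , ≋-refl
... | inj₁ refl        | inj₂ (inj₁ refl) = a , 1F , rotate-≋ (canonical a 1F)
... | inj₁ refl        | inj₂ (inj₂ refl) = c , 2F , ≋-refl
... | inj₂ (inj₁ refl) | inj₁ refl        = a , 2F , rotate²-≋ (canonical a 2F)
... | inj₂ (inj₁ refl) | inj₂ (inj₁ refl) = ⊥-elim (1+n≰n (proj₁ ca))
... | inj₂ (inj₁ refl) | inj₂ (inj₂ refl) = c , 1F , rotate²-≋ (canonical c 1F)
... | inj₂ (inj₂ refl) | inj₁ refl        = b , 1F , ≋-refl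
... | inj₂ (inj₂ refl) | inj₂ (inj₁ refl) = b , 2F , rotate-≋ (canonical b 2F)
... | inj₂ (inj₂ refl) | inj₂ (inj₂ refl) = ⊥-elim (1+n≰n (proj₂ ca))

total-≋-canonical : ∀ {x m k} → x ≋ canonical m k → total x ≡ toℕ k + m * 3
total-≋-canonical {m = m} {k} x≋ = trans (_≋_.total-≡ x≋) (total-canonical m k)

balanced-≼ : ∀ {x y} → Balanced₃ x → Balanced₃ y → total x ≡ total y → x ≼ y
balanced-≼ {x} {y} bx by total≡ with classify x bx | classify y by
... | m , k , x≋ | m′ , k′ , y≋
  with refl , refl ← canonical-unique {m} {m′} {k} {k′}
                       (trans (sym (total-≋-canonical x≋)) (trans total≡ (total-≋-canonical y≋))) =
  ≋⇒≼ (≋-trans x≋ (≋-sym y≋))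

≼-balanced : ∀ x {y} → Balanced₃ y → total x ≡ total y → x ≼ y
≼-balanced x by total≡ with descend x (<-wellFounded (squares x))
... | z , bz , total-z , x≼z = ≼-trans x≼z (balanced-≼ bz by (trans total-z total≡))

sizes-balanced : ∀ {n} (W : Partition n) → Balanced W → Balanced₃ (sizes W)
sizes-balanced W balanced = near 0F 1F , near 1F 2F , near 2F 0F
  where
  bound : ∀ i j → size W i ≤ suc (size W j)
  bound i j = subst₂ _≤_ (partSize≡size W i) (trans (cong (_+ 1) (partSize≡size W j)) (+-comm _ 1))
                         (balanced i j)
  near : ∀ i j → Near (size W i) (size W j)
  near i j = bound i j , bound j i

norm2-mono : ∀ {n} (V W : Partition n) → sizes V ≼ sizes W → norm2 V ≤ norm2 W
norm2-mono V W (≼-intro le) = *-cancelˡ-≤ 2 (+-cancelʳ-≤ (Nv + Nw) _ _ (subst₂ _≤_ lhs rhs le))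
  where
  Nv = Φ⁻ (sizes V)
  Nw = Φ⁻ (sizes W)
  lhs : Φ⁺ (sizes V) + Nw ≡ 2 * norm2 V + (Nv + Nw)
  lhs = trans (cong (_+ Nw) (sym (norm2-identity V))) (+-assoc (2 * norm2 V) Nv Nw)
  rhs : Φ⁺ (sizes W) + Nv ≡ 2 * norm2 W + (Nv + Nw)
  rhs = trans (cong (_+ Nv) (sym (norm2-identity W)))
              (trans (+-assoc (2 * norm2 W) Nw Nv) (cong (2 * norm2 W +_) (+-comm Nw Nv)))

fact3p1 : (n : ℕ) → n ≥ 6 → (V W : Partition n) → Balanced W →
    norm2 V ≤ norm2 W
fact3p1 n _ V W balanced = norm2-mono V W
  (≼-balanced (sizes V) (sizes-balanced W balanced) (trans (total-sizes V) (sym (total-sizes W))))
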